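{- Let $r\geq 2$ and $n_2,\dots,n_r$ be positive integers such that $r,n_2,\dots,n_r$ are all odd and the number of edges $|E(K_{1,n_2,\dots,n_r})|$ is odd. Then $w_c(K_{1,n_2,\dots,n_r})=1+\sum_{i=2}^r n_i$.
   Context: $K_{n_1,\dots,n_r}$ is the simple graph whose vertex set is partitioned into independent sets $V_1,\dots,V_r$ with $|V_i|=n_i$, and in which every vertex of $V_i$ is adjacent to every vertex of $V_j$ for all $i\neq j$; here $n_1=1$. A proper $t$-edge coloring of $G$ is a map $\alpha:E(G)\to\{1,\dots,t\}$ with $\alpha(e)\neq\alpha(e')$ for adjacent edges $e,e'$; $S(v,\alpha)$ is the set of colors on edges incident to $v$. A proper $t$-edge coloring $\alpha$ is a cyclic interval $t$-coloring if for every vertex $v$, either $S(v,\alpha)$ or $\{1,\dots,t\}\setminus S(v,\alpha)$ is a set of consecutive integers. For a graph $G$ having a cyclic interval $t$-coloring for some $t$, $w_c(G)$ denotes the least such $t$. -}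

module Defs where

open import Data.Nat using (ℕ; zero; suc; _+_; _*_; _≤_; _<_; _<ᵇ_; _%_)
open import Data.Bool using (if_then_else_)
open import Data.Fin using (Fin; zero; suc; toℕ)
open import Data.Product using (Σ; ∃; _×_; _,_; proj₁)
open import Relation.Binary.PropositionalEquality using (_≡_; _≢_)
open import Relation.Nullary using (¬_)
import Data.Sum

Odd : ℕ → Set
Odd n = n % 2 ≡ 1

sumFin : {m : ℕ} → (Fin m → ℕ) → ℕ
sumFin {zero}  f = 0
sumFin {suc m} f = f zero + sumFin (λ i → f (suc i))

-- Part sizes of K_{1,n_2,...,n_r}, with r = suc k and ns i = n_{i+2}.
sizes : {k : ℕ} → (Fin k → ℕ) → Fin (suc k) → ℕ
sizes ns zero    = 1
sizes ns (suc i) = ns i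

Vertex : {k : ℕ} → (Fin k → ℕ) → Set
Vertex {k} ns = Σ (Fin (suc k)) (λ i → Fin (sizes ns i))

Adj : {k : ℕ} {ns : Fin k → ℕ} → Vertex ns → Vertex ns → Set
Adj u v = proj₁ u ≢ proj₁ v

edgeCount : {m : ℕ} → (Fin m → ℕ) → ℕ
edgeCount f = sumFin (λ i → sumFin (λ j → if toℕ i <ᵇ toℕ j then f i * f j else 0))

-- A proper t-edge coloring, given as a function on ordered pairs of
-- vertices that is only meaningful (and symmetric) on adjacent pairs.
record ProperColoring {k : ℕ} (ns : Fin k → ℕ) (t : ℕ) (c : Vertex ns → Vertex ns → ℕ) : Set where
  field
    inRange   : ∀ u v → Adj {ns = ns} u v → 1 ≤ c u v × c u v ≤ t
    symmetric : ∀ u v → Adj {ns = ns} u v → c u v ≡ c v u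
    proper    : ∀ v u w → Adj {ns = ns} v u → Adj {ns = ns} v w → u ≢ w → c v u ≢ c v w

InS : {k : ℕ} (ns : Fin k → ℕ) (c : Vertex ns → Vertex ns → ℕ) → Vertex ns → ℕ → Set
InS ns c v x = ∃ λ u → Adj {ns = ns} v u × c v u ≡ x

-- A set of consecutive integers (possibly empty, when a > b).
IsInterval : (ℕ → Set) → Set
IsInterval P = ∃ λ a → ∃ λ b → ∀ x → (P x → a ≤ x × x ≤ b) × (a ≤ x × x ≤ b → P x)

record CyclicIntervalColoring {k : ℕ} (ns : Fin k → ℕ) (t : ℕ) (c : Vertex ns → Vertex ns → ℕ) : Set where
  field
    isProper : ProperColoring ns t c
    cyclic   : ∀ v → IsInterval (InS ns c v)
                     Data.Sum.⊎ IsInterval (λ x → (1 ≤ x × x ≤ t) × ¬ InS ns c v x)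

HasCIC : {k : ℕ} (ns : Fin k → ℕ) → ℕ → Set
HasCIC ns t = ∃ λ c → CyclicIntervalColoring ns t c

WcEq : {k : ℕ} (ns : Fin k → ℕ) → ℕ → Set
WcEq ns w = HasCIC ns w × (∀ t → HasCIC ns t → w ≤ t)

-- Write V = 1 + n₂ + ⋯ + n_r for the number of vertices.
--
-- Upper bound: number the vertices 0, …, V − 1 part by part and color the edge uw with 1 + (u + w) mod V.
-- This is proper, and the colors missing at v are those coming from v's own part, a run of consecutive
-- numbers; so they form an arc of ℤ/V, and the colors present at v form a cyclic interval.
--
-- Lower bound: the center is adjacent to all other V − 1 vertices, so t ≥ V − 1.  If t = V − 1, then t is
-- even (an even number r − 1 of odd summands) and so is every degree V − nᵢ.  A cyclic interval of 2D colors
-- in {1, …, t} with t even contains exactly D odd colors, so every vertex meets as many odd-colored edges as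
-- half its degree.  Summing over the vertices, |E| = ∑ deg v / 2 is twice the number of odd-colored edges,
-- contradicting |E| odd.

module Submission where

open import Defs
open import Data.Nat
  using (ℕ; zero; suc; _+_; _*_; _∸_; _≤_; _<_; _%_; _/_; z≤n; s≤s; s≤s⁻¹; _≤?_; _<?_; NonZero)
open import Data.Nat.Properties
open import Data.Nat.DivMod
  using (m≡m%n+[m/n]*n; m%n<n; m<n⇒m%n≡m; [m+n]%n≡m%n; %-distribˡ-+; m%n%n≡m%n; m≤n⇒[n∸m]%m≡n%m)
open import Data.Nat.Divisibility using (_∣_; divides; _∣0; ∣m∣n⇒∣m+n; ∣m+n∣m⇒∣n; n∣m⇒m%n≡0)
open import Data.Nat.Tactic.RingSolver using (solve-∀)
open import Algebra.Properties.Semiring.Sum +-*-semiring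
  using (sum; sum-syntax; sum-cong-≗; sum-replicate-zero; ∑-distrib-+; ∑-comm; *-distribˡ-sum; *-distribʳ-sum)
open import Data.Fin using (Fin; zero; suc; toℕ; fromℕ<)
import Data.Fin.Properties as Fin
open import Data.Product using (Σ; ∃; ∃₂; _×_; _,_; proj₁; proj₂)
open import Data.Product.Properties using (≡-dec; ,-injectiveˡ; ,-injectiveʳ-UIP)
open import Data.Sum using (_⊎_; inj₁; inj₂)
open import Data.Empty using (⊥)
open import Function using (_∘_; _∋_)
open import Relation.Nullary using (¬_; Dec; yes; no; ¬?; _×-dec_; contradiction)
open import Relation.Binary using (tri<; tri≈; tri>)
open import Relation.Binary.PropositionalEquality
open import Axiom.UniquenessOfIdentityProofs using (module Decidable⇒UIP)
open import Algebra.Properties.CommutativeSemigroup +-commutativeSemigroup using (x∙yz≈y∙xz)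

𝟙 : {P : Set} → Dec P → ℕ
𝟙 (yes _) = 1
𝟙 (no _)  = 0

module _ {P : Set} where

  𝟙-yes : (d : Dec P) → P → 𝟙 d ≡ 1
  𝟙-yes (yes _) _ = refl
  𝟙-yes (no ¬p) p = contradiction p ¬p

  𝟙-no : (d : Dec P) → ¬ P → 𝟙 d ≡ 0
  𝟙-no (yes p) ¬p = contradiction p ¬p
  𝟙-no (no _)  _  = refl

  𝟙≤1 : (d : Dec P) → 𝟙 d ≤ 1
  𝟙≤1 (yes _) = s≤s z≤n
  𝟙≤1 (no _)  = z≤n

  𝟙-¬?+𝟙 : (d : Dec P) → 𝟙 (¬? d) + 𝟙 d ≡ 1
  𝟙-¬?+𝟙 (yes _) = refl
  𝟙-¬?+𝟙 (no _)  = refl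

module _ {P Q : Set} where

  𝟙*𝟙≤1 : (d : Dec P) (e : Dec Q) → 𝟙 d * 𝟙 e ≤ 1
  𝟙*𝟙≤1 d e = *-mono-≤ (𝟙≤1 d) (𝟙≤1 e)

  𝟙*𝟙-yes : (d : Dec P) (e : Dec Q) → P → Q → 𝟙 d * 𝟙 e ≡ 1
  𝟙*𝟙-yes d e p q = cong₂ _*_ (𝟙-yes d p) (𝟙-yes e q)

  𝟙*𝟙-sound : (d : Dec P) (e : Dec Q) → 1 ≤ 𝟙 d * 𝟙 e → P × Q
  𝟙*𝟙-sound (yes p) (yes q) _ = p , q

𝟙-≢-split : ∀ {n} (i j : Fin n) → 𝟙 (¬? (i Fin.≟ j)) ≡ 𝟙 (i Fin.<? j) + 𝟙 (j Fin.<? i)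
𝟙-≢-split i j with Fin.<-cmp i j
... | tri< i<j i≢j _ = trans (𝟙-yes (¬? (i Fin.≟ j)) i≢j)
                             (sym (cong₂ _+_ (𝟙-yes (i Fin.<? j) i<j) (𝟙-no (j Fin.<? i) (Fin.<-asym i<j))))
... | tri≈ _ i≡j _   = trans (𝟙-no (¬? (i Fin.≟ j)) (λ i≢j → i≢j i≡j))
                             (sym (cong₂ _+_ (𝟙-no (i Fin.<? j) (Fin.<-irrefl i≡j))
                                             (𝟙-no (j Fin.<? i) (Fin.<-irrefl (sym i≡j)))))
... | tri> _ i≢j j<i = trans (𝟙-yes (¬? (i Fin.≟ j)) i≢j)
                             (sym (cong₂ _+_ (𝟙-no (i Fin.<? j) (Fin.<-asym j<i)) (𝟙-yes (j Fin.<? i) j<i)))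

-- Finite sums

sumFin≡sum : ∀ {m} (f : Fin m → ℕ) → sumFin f ≡ sum f
sumFin≡sum {zero}  f = refl
sumFin≡sum {suc m} f = cong (f zero +_) (sumFin≡sum (f ∘ suc))

sum-zero : ∀ {m} {f : Fin m → ℕ} → (∀ i → f i ≡ 0) → sum f ≡ 0
sum-zero {m} f≗0 = trans (sum-cong-≗ f≗0) (sum-replicate-zero m)

sum-const : ∀ m a → sum {m} (λ _ → a) ≡ m * a
sum-const zero    a = refl
sum-const (suc m) a = cong (a +_) (sum-const m a)

sum-mono : ∀ {m} {f g : Fin m → ℕ} → (∀ i → f i ≤ g i) → sum f ≤ sum g
sum-mono {zero}  f≤g = z≤n
sum-mono {suc m} f≤g = +-mono-≤ (f≤g zero) (sum-mono (f≤g ∘ suc))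

sum-≥ : ∀ {m} (f : Fin m → ℕ) i → f i ≤ sum f
sum-≥ f zero    = m≤m+n (f zero) _
sum-≥ f (suc i) = ≤-trans (sum-≥ (f ∘ suc) i) (m≤n+m _ (f zero))

sum-pos : ∀ {m} (f : Fin m → ℕ) → 1 ≤ sum f → ∃ λ i → 1 ≤ f i
sum-pos {suc m} f 1≤∑ with f zero in eq
... | suc _ = zero , subst (1 ≤_) (sym eq) (s≤s z≤n)
... | zero  = let i , 1≤fi = sum-pos (f ∘ suc) 1≤∑ in suc i , 1≤fi

sum-single : ∀ {m} (f : Fin m → ℕ) p → (∀ i → i ≢ p → f i ≡ 0) → sum f ≡ f p
sum-single f zero    off-p = trans (cong (f zero +_) (sum-zero λ i → off-p (suc i) λ ())) (+-identityʳ (f zero))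
sum-single f (suc p) off-p =
  cong₂ _+_ (off-p zero λ ()) (sum-single (f ∘ suc) p λ i i≢p → off-p (suc i) (i≢p ∘ Fin.suc-injective))

sum-≤1 : ∀ {m} (f : Fin m → ℕ) → (∀ i → f i ≤ 1) → (∀ i j → 1 ≤ f i → 1 ≤ f j → i ≡ j) →
         sum f ≤ 1
sum-≤1 {zero}  f ≤1 unique = z≤n
sum-≤1 {suc m} f ≤1 unique with 1 ≤? f zero
... | no  1≰f₀ = subst (_≤ 1) (cong (_+ sum (f ∘ suc)) (sym (n<1⇒n≡0 (≰⇒> 1≰f₀))))
                   (sum-≤1 (f ∘ suc) (≤1 ∘ suc) λ i j p q → Fin.suc-injective (unique (suc i) (suc j) p q))
... | yes 1≤f₀ = subst (_≤ 1) (sym (trans (cong (f zero +_) rest≡0) (+-identityʳ (f zero)))) (≤1 zero)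
  where
  rest≡0 : sum (f ∘ suc) ≡ 0
  rest≡0 = sum-zero λ i → n<1⇒n≡0 (≰⇒> λ 1≤fi → contradiction (unique zero (suc i) 1≤f₀ 1≤fi) λ ())

∣-sum : ∀ {d m} (f : Fin m → ℕ) → (∀ i → d ∣ f i) → d ∣ sum f
∣-sum {d} {zero}  f d∣f = d ∣0
∣-sum {d} {suc m} f d∣f = ∣m∣n⇒∣m+n (d∣f zero) (∣-sum (f ∘ suc) (d∣f ∘ suc))

-- Sums over initial segments of ℕ

∑< : ℕ → (ℕ → ℕ) → ℕ
∑< T h = ∑[ x < T ] h (toℕ x)

∑<-cong : ∀ T {g h : ℕ → ℕ} → (∀ x → x < T → g x ≡ h x) → ∑< T g ≡ ∑< T h
∑<-cong T g≗h = sum-cong-≗ λ i → g≗h (toℕ i) (Fin.toℕ<n i)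

∑<-zero : ∀ T {h : ℕ → ℕ} → (∀ x → x < T → h x ≡ 0) → ∑< T h ≡ 0
∑<-zero T h≗0 = trans (∑<-cong T h≗0) (sum-replicate-zero T)

∑<-pointwise-+ : ∀ T (f g : ℕ → ℕ) {e : ℕ → ℕ} → (∀ x → f x + g x ≡ e x) →
                 ∑< T f + ∑< T g ≡ ∑< T e
∑<-pointwise-+ T f g f+g≗e =
  trans (sym (∑-distrib-+ {T} (f ∘ toℕ) (g ∘ toℕ))) (sum-cong-≗ {T} λ i → f+g≗e (toℕ i))

∑<-split : ∀ m n (g : ℕ → ℕ) → ∑< (m + n) g ≡ ∑< m g + ∑< n (λ y → g (y + m))
∑<-split zero    n g = ∑<-cong n λ y _ → cong g (sym (+-identityʳ y))
∑<-split (suc m) n g = begin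
  g 0 + ∑< (m + n) (g ∘ suc)
    ≡⟨ cong (g 0 +_) (∑<-split m n (g ∘ suc)) ⟩
  g 0 + (∑< m (g ∘ suc) + ∑< n (λ y → g (suc (y + m))))
    ≡⟨ cong (λ s → g 0 + (∑< m (g ∘ suc) + s)) (∑<-cong n λ y _ → cong g (sym (+-suc y m))) ⟩
  g 0 + (∑< m (g ∘ suc) + ∑< n (λ y → g (y + suc m)))
    ≡⟨ +-assoc (g 0) _ _ ⟨
  ∑< (suc m) g + ∑< n (λ y → g (y + suc m))
    ∎
  where open ≡-Reasoning

∑<-support : ∀ a L T (g : ℕ → ℕ) → a + L ≤ T → (∀ x → x < a ⊎ a + L ≤ x → g x ≡ 0) →
             ∑< T g ≡ ∑< L (λ y → g (y + a))
∑<-support a L T g a+L≤T outside≡0 = begin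
  ∑< T g                             ≡⟨ cong (λ T → ∑< T g) T≡ ⟨
  ∑< (a + (L + r)) g                 ≡⟨ ∑<-split a (L + r) g ⟩
  ∑< a g + ∑< (L + r) g′             ≡⟨ cong₂ _+_ (∑<-zero a below) (∑<-split L r g′) ⟩
  ∑< L g′ + ∑< r (λ z → g′ (z + L))  ≡⟨ cong (∑< L g′ +_) (∑<-zero r above) ⟩
  ∑< L g′ + 0                        ≡⟨ +-identityʳ _ ⟩
  ∑< L g′                            ∎
  where
  open ≡-Reasoning
  g′ = λ y → g (y + a)
  r = T ∸ (a + L)
  T≡ : a + (L + r) ≡ T
  T≡ = trans (sym (+-assoc a L r)) (m+[n∸m]≡n a+L≤T)
  below : ∀ x → x < a → g x ≡ 0
  below x x<a = outside≡0 x (inj₁ x<a)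
  above : ∀ z → z < r → g′ (z + L) ≡ 0
  above z _ = outside≡0 _ (inj₂ (subst (a + L ≤_) z+[a+L]≡ (m≤n+m (a + L) z)))
    where
    z+[a+L]≡ : z + (a + L) ≡ z + L + a
    z+[a+L]≡ = trans (cong (z +_) (+-comm a L)) (sym (+-assoc z L a))

∑<-pick : ∀ {T y} (h : ℕ → ℕ) → y < T → ∑< T (λ x → 𝟙 (y ≟ x) * h x) ≡ h y
∑<-pick {T} {y} h y<T = begin
  ∑< T (λ x → 𝟙 (y ≟ x) * h x)  ≡⟨ ∑<-support y 1 T _ (subst (_≤ T) (+-comm 1 y) y<T) outside≡0 ⟩
  𝟙 (y ≟ y) * h y + 0           ≡⟨ +-identityʳ _ ⟩
  𝟙 (y ≟ y) * h y               ≡⟨ cong (_* h y) (𝟙-yes (y ≟ y) refl) ⟩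
  1 * h y                       ≡⟨ *-identityˡ (h y) ⟩
  h y                           ∎
  where
  open ≡-Reasoning
  outside≡0 : ∀ x → x < y ⊎ y + 1 ≤ x → 𝟙 (y ≟ x) * h x ≡ 0
  outside≡0 x (inj₁ x<y)   = cong (_* h x) (𝟙-no (y ≟ x) λ y≡x → <⇒≢ x<y (sym y≡x))
  outside≡0 x (inj₂ y+1≤x) =
    cong (_* h x) (𝟙-no (y ≟ x) λ y≡x → <⇒≢ (subst (_≤ x) (+-comm y 1) y+1≤x) y≡x)

parity : ℕ → ℕ
parity zero          = 0
parity (suc zero)    = 1
parity (suc (suc n)) = parity n

parity+parity-suc : ∀ a → parity a + parity (suc a) ≡ 1
parity+parity-suc zero          = refl
parity+parity-suc (suc zero)    = refl
parity+parity-suc (suc (suc a)) = parity+parity-suc a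

∑<-parity : ∀ M a → ∑< (M * 2) (λ y → parity (y + a)) ≡ M
∑<-parity zero    a = refl
∑<-parity (suc M) a = begin
  parity a + (parity (suc a) + ∑< (M * 2) (λ y → parity (y + a)))
    ≡⟨ +-assoc (parity a) _ _ ⟨
  parity a + parity (suc a) + ∑< (M * 2) (λ y → parity (y + a))
    ≡⟨ cong₂ _+_ (parity+parity-suc a) (∑<-parity M a) ⟩
  suc M
    ∎
  where open ≡-Reasoning

χ : ℕ → ℕ → ℕ → ℕ
χ a b x = 𝟙 (a ≤? x ×-dec x ≤? b)

χ-in : ∀ {a b x} → a ≤ x × x ≤ b → χ a b x ≡ 1
χ-in {a} {b} {x} = 𝟙-yes (a ≤? x ×-dec x ≤? b)

χ-out : ∀ {a b x} → ¬ (a ≤ x × x ≤ b) → χ a b x ≡ 0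
χ-out {a} {b} {x} = 𝟙-no (a ≤? x ×-dec x ≤? b)

∑<-χ : ∀ {a b T} (h : ℕ → ℕ) → a ≤ b → b < T →
       ∑< T (λ x → χ a b x * h x) ≡ ∑< (suc b ∸ a) (λ y → h (y + a))
∑<-χ {a} {b} {T} h a≤b b<T =
  trans (∑<-support a L T _ (subst (_≤ T) (sym a+L≡) b<T) outside≡0) (∑<-cong L inside)
  where
  L = suc b ∸ a
  a+L≡ : a + L ≡ suc b
  a+L≡ = m+[n∸m]≡n (m≤n⇒m≤1+n a≤b)
  outside≡0 : ∀ x → x < a ⊎ a + L ≤ x → χ a b x * h x ≡ 0
  outside≡0 x (inj₁ x<a)   = cong (_* h x) (χ-out {a} λ (a≤x , _) → <⇒≱ x<a a≤x)
  outside≡0 x (inj₂ a+L≤x) =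
    cong (_* h x) (χ-out {a} λ (_ , x≤b) → <⇒≱ (subst (_≤ x) a+L≡ a+L≤x) x≤b)
  inside : ∀ y → y < L → χ a b (y + a) * h (y + a) ≡ h (y + a)
  inside y y<L = trans (cong (_* h (y + a)) (χ-in {a} (m≤n+m a y , y+a≤b))) (*-identityˡ _)
    where
    y+a≤b : y + a ≤ b
    y+a≤b = s≤s⁻¹ (subst (suc (y + a) ≤_) (trans (+-comm L a) a+L≡) (+-monoˡ-≤ a y<L))

χ-empty : ∀ {a b} x → b < a → χ a b x ≡ 0
χ-empty {a} x b<a = χ-out {a} λ (a≤x , x≤b) → <⇒≱ b<a (≤-trans a≤x x≤b)

χ-count : ∀ a b T → (a ≤ b → b < T) → ∑< T (χ a b) ≡ suc b ∸ a
χ-count a b T bound with a ≤? b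
... | yes a≤b = begin
  ∑< T (χ a b)                  ≡⟨ ∑<-cong T (λ x _ → *-identityʳ (χ a b x)) ⟨
  ∑< T (λ x → χ a b x * 1)      ≡⟨ ∑<-χ (λ _ → 1) a≤b (bound a≤b) ⟩
  ∑< (suc b ∸ a) (λ _ → 1)      ≡⟨ sum-const (suc b ∸ a) 1 ⟩
  (suc b ∸ a) * 1               ≡⟨ *-identityʳ _ ⟩
  suc b ∸ a                     ∎
  where open ≡-Reasoning
... | no a≰b = trans (∑<-zero T λ x _ → χ-empty x (≰⇒> a≰b)) (sym (m≤n⇒m∸n≡0 (≰⇒> a≰b)))

χ-parity : ∀ a b T M → (a ≤ b → b < T) → ∑< T (χ a b) ≡ M * 2 → ∑< T (λ x → χ a b x * parity x) ≡ M
χ-parity a b T M bound count with a ≤? b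
... | yes a≤b = begin
  ∑< T (λ x → χ a b x * parity x)           ≡⟨ ∑<-χ parity a≤b (bound a≤b) ⟩
  ∑< (suc b ∸ a) (λ y → parity (y + a))     ≡⟨ cong (λ L → ∑< L (λ y → parity (y + a))) L≡ ⟩
  ∑< (M * 2) (λ y → parity (y + a))         ≡⟨ ∑<-parity M a ⟩
  M                                         ∎
  where
  open ≡-Reasoning
  L≡ : suc b ∸ a ≡ M * 2
  L≡ = trans (sym (χ-count a b T bound)) count
... | no a≰b = trans (∑<-zero T λ x _ → cong (_* parity x) (χ-empty x (≰⇒> a≰b))) (sym (M≡0 M M*2≡0))
  where
  M*2≡0 : M * 2 ≡ 0
  M*2≡0 = trans (sym count) (∑<-zero T λ x _ → χ-empty x (≰⇒> a≰b))
  M≡0 : ∀ M → M * 2 ≡ 0 → M ≡ 0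
  M≡0 zero _ = refl

-- Cyclic intervals

CyclicInterval : ℕ → (ℕ → Set) → Set
CyclicInterval t P = IsInterval P ⊎ IsInterval (λ x → (1 ≤ x × x ≤ t) × ¬ P x)

Indicates : (ℕ → ℕ) → (ℕ → Set) → Set
Indicates χP P = ∀ x → (P x × χP x ≡ 1) ⊎ (¬ P x × χP x ≡ 0)

module _ {t s D : ℕ} {P : ℕ → Set} {χP : ℕ → ℕ} (χP-indicates : Indicates χP P)
         (P⊆range : ∀ x → P x → 1 ≤ x × x ≤ t) (t≡ : t ≡ s * 2) (count : ∑< (suc t) χP ≡ D * 2) where

  interval-parity : IsInterval P → ∑< (suc t) (λ x → χP x * parity x) ≡ D
  interval-parity (a , b , P⇔) =
    trans (∑<-cong (suc t) λ x _ → cong (_* parity x) (χP≗χ x))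
          (χ-parity a b (suc t) D b<1+t (trans (sym (∑<-cong (suc t) λ x _ → χP≗χ x)) count))
    where
    χP≗χ : ∀ x → χP x ≡ χ a b x
    χP≗χ x with χP-indicates x
    ... | inj₁ (Px , χ≡1)  = trans χ≡1 (sym (χ-in {a} (proj₁ (P⇔ x) Px)))
    ... | inj₂ (¬Px , χ≡0) = trans χ≡0 (sym (χ-out {a} (¬Px ∘ proj₂ (P⇔ x))))
    b<1+t : a ≤ b → b < suc t
    b<1+t a≤b = s≤s (proj₂ (P⊆range b (proj₂ (P⇔ b) (a≤b , ≤-refl))))

  -- P and [a, b] split [1, t]; both [1, t] and [a, b] are intervals of even length.
  module Cointerval (coP-interval : IsInterval (λ x → (1 ≤ x × x ≤ t) × ¬ P x)) where
    a = proj₁ coP-interval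
    b = proj₁ (proj₂ coP-interval)
    coP⇔ = proj₂ (proj₂ coP-interval)

    pointwise : ∀ x → χP x + χ a b x ≡ χ 1 t x
    pointwise x with χP-indicates x
    ... | inj₁ (Px , χ≡1)  =
      trans (cong₂ _+_ χ≡1 (χ-out {a} λ ab → proj₂ (proj₂ (coP⇔ x) ab) Px)) (sym (χ-in {1} (P⊆range x Px)))
    ... | inj₂ (¬Px , χ≡0) = trans (cong (_+ χ a b x) χ≡0) (absent (1 ≤? x ×-dec x ≤? t))
      where
      absent : Dec (1 ≤ x × x ≤ t) → χ a b x ≡ χ 1 t x
      absent (yes in-range)    =
        trans (χ-in {a} (proj₁ (coP⇔ x) (in-range , ¬Px))) (sym (χ-in {1} in-range))
      absent (no out-of-range) =
        trans (χ-out {a} λ ab → out-of-range (proj₁ (proj₂ (coP⇔ x) ab))) (sym (χ-out {1} out-of-range))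

    count₁ₜ : ∑< (suc t) (χ 1 t) ≡ t
    count₁ₜ = χ-count 1 t (suc t) (λ _ → ≤-refl)

    counts : D * 2 + ∑< (suc t) (χ a b) ≡ s * 2
    counts = begin
      D * 2 + ∑< (suc t) (χ a b)          ≡⟨ cong (_+ ∑< (suc t) (χ a b)) count ⟨
      ∑< (suc t) χP + ∑< (suc t) (χ a b)  ≡⟨ ∑<-pointwise-+ (suc t) χP (χ a b) pointwise ⟩
      ∑< (suc t) (χ 1 t)                  ≡⟨ count₁ₜ ⟩
      t                                   ≡⟨ t≡ ⟩
      s * 2                               ∎
      where open ≡-Reasoning

    b<1+t : a ≤ b → b < suc t
    b<1+t a≤b = s≤s (proj₂ (proj₁ (proj₂ (coP⇔ b) (a≤b , ≤-refl))))

    oddPart : (ℕ → ℕ) → ℕ → ℕ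
    oddPart f x = f x * parity x

    oddCount : (ℕ → ℕ) → ℕ
    oddCount f = ∑< (suc t) (oddPart f)

    parity-count : oddCount χP ≡ D
    parity-count with ∣m+n∣m⇒∣n (divides s counts) (divides D refl)
    ... | divides M L≡M*2 = +-cancelʳ-≡ M _ D (begin
      oddCount χP + M                 ≡⟨ cong (oddCount χP +_) (χ-parity a b (suc t) M b<1+t L≡M*2) ⟨
      oddCount χP + oddCount (χ a b)  ≡⟨ ∑<-pointwise-+ (suc t) (oddPart χP) (oddPart (χ a b)) weighted ⟩
      oddCount (χ 1 t)                ≡⟨ χ-parity 1 t (suc t) s (λ _ → ≤-refl) (trans count₁ₜ t≡) ⟩
      s                               ≡⟨ *-cancelʳ-≡ (D + M) s 2 [D+M]*2≡s*2 ⟨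
      D + M                           ∎)
      where
      open ≡-Reasoning
      weighted : ∀ x → χP x * parity x + χ a b x * parity x ≡ χ 1 t x * parity x
      weighted x = trans (sym (*-distribʳ-+ (parity x) (χP x) (χ a b x))) (cong (_* parity x) (pointwise x))
      [D+M]*2≡s*2 : (D + M) * 2 ≡ s * 2
      [D+M]*2≡s*2 = trans (*-distribʳ-+ 2 D M) (trans (cong (D * 2 +_) (sym L≡M*2)) counts)

  cyclicInterval-parity : CyclicInterval t P → ∑< (suc t) (λ x → χP x * parity x) ≡ D
  cyclicInterval-parity (inj₁ P-interval)   = interval-parity P-interval
  cyclicInterval-parity (inj₂ coP-interval) = Cointerval.parity-count coP-interval

record Complementary (t : ℕ) (P Q : ℕ → Set) : Set where
  field
    P⊆range  : ∀ x → P x → 1 ≤ x × x ≤ t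
    Q⊆range  : ∀ x → Q x → 1 ≤ x × x ≤ t
    disjoint : ∀ x → P x → Q x → ⊥
    cover    : ∀ x → 1 ≤ x × x ≤ t → P x ⊎ Q x

IsInterval-resp : {P Q : ℕ → Set} → (∀ x → P x → Q x) → (∀ x → Q x → P x) →
                  IsInterval P → IsInterval Q
IsInterval-resp P→Q Q→P (a , b , P⇔) = a , b , λ x → proj₁ (P⇔ x) ∘ Q→P x , P→Q x ∘ proj₂ (P⇔ x)

complementary-cyclic : ∀ {t} {P Q : ℕ → Set} → Complementary t P Q → CyclicInterval t Q → CyclicInterval t P
complementary-cyclic {t} {P} {Q} PQ (inj₁ Q-interval) = inj₂ (IsInterval-resp Q→coP coP→Q Q-interval)
  where
  open Complementary PQ
  Q→coP : ∀ x → Q x → (1 ≤ x × x ≤ t) × ¬ P x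
  Q→coP x Qx = Q⊆range x Qx , λ Px → disjoint x Px Qx
  coP→Q : ∀ x → (1 ≤ x × x ≤ t) × ¬ P x → Q x
  coP→Q x (in-range , ¬Px) with cover x in-range
  ... | inj₁ Px = contradiction Px ¬Px
  ... | inj₂ Qx = Qx
complementary-cyclic {t} {P} {Q} PQ (inj₂ coQ-interval) = inj₁ (IsInterval-resp coQ→P P→coQ coQ-interval)
  where
  open Complementary PQ
  coQ→P : ∀ x → (1 ≤ x × x ≤ t) × ¬ Q x → P x
  coQ→P x (in-range , ¬Qx) with cover x in-range
  ... | inj₁ Px = Px
  ... | inj₂ Qx = contradiction Qx ¬Qx
  P→coQ : ∀ x → P x → (1 ≤ x × x ≤ t) × ¬ Q x
  P→coQ x Px = P⊆range x Px , disjoint x Px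

-- Arcs of ℤ/V

module _ {V : ℕ} .{{_ : NonZero V}} where

  [m%V+n]%V≡[m+n]%V : ∀ m n → (m % V + n) % V ≡ (m + n) % V
  [m%V+n]%V≡[m+n]%V m n = begin
    (m % V + n) % V          ≡⟨ %-distribˡ-+ (m % V) n V ⟩
    (m % V % V + n % V) % V  ≡⟨ cong (λ r → (r + n % V) % V) (m%n%n≡m%n m V) ⟩
    (m % V + n % V) % V      ≡⟨ %-distribˡ-+ m n V ⟨
    (m + n) % V              ∎
    where open ≡-Reasoning

  [m+n%V]%V≡[m+n]%V : ∀ m n → (m + n % V) % V ≡ (m + n) % V
  [m+n%V]%V≡[m+n]%V m n = begin
    (m + n % V) % V  ≡⟨ cong (_% V) (+-comm m (n % V)) ⟩
    (n % V + m) % V  ≡⟨ [m%V+n]%V≡[m+n]%V n m ⟩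
    (n + m) % V      ≡⟨ cong (_% V) (+-comm n m) ⟩
    (m + n) % V      ∎
    where open ≡-Reasoning

  +-inverse-% : ∀ x y → (x + (y + (V ∸ x % V))) % V ≡ y % V
  +-inverse-% x y = begin
    (x + (y + (V ∸ x % V))) % V    ≡⟨ [m%V+n]%V≡[m+n]%V x _ ⟨
    (x % V + (y + (V ∸ x % V))) % V ≡⟨ cong (_% V) (x∙yz≈y∙xz (x % V) y _) ⟩
    (y + (x % V + (V ∸ x % V))) % V ≡⟨ cong (λ r → (y + r) % V) (m+[n∸m]≡n (<⇒≤ (m%n<n x V))) ⟩
    (y + V) % V                     ≡⟨ [m+n]%n≡m%n y V ⟩
    y % V                           ∎
    where open ≡-Reasoning

  +-%-cancelˡ : ∀ x {y y′} → y < V → y′ < V → (x + y) % V ≡ (x + y′) % V → y ≡ y′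
  +-%-cancelˡ x {y} {y′} y<V y′<V eq = begin
    y                                      ≡⟨ m<n⇒m%n≡m y<V ⟨
    y % V                                  ≡⟨ unshift y ⟨
    ((x + y) % V + (V ∸ x % V)) % V        ≡⟨ cong (λ r → (r + (V ∸ x % V)) % V) eq ⟩
    ((x + y′) % V + (V ∸ x % V)) % V       ≡⟨ unshift y′ ⟩
    y′ % V                                 ≡⟨ m<n⇒m%n≡m y′<V ⟩
    y′                                     ∎
    where
    open ≡-Reasoning
    unshift : ∀ y → ((x + y) % V + (V ∸ x % V)) % V ≡ y % V
    unshift y = trans ([m%V+n]%V≡[m+n]%V (x + y) _) (trans (cong (_% V) (+-assoc x y _)) (+-inverse-% x y))

  +-%-surjective : ∀ x {z} → z < V → ∃ λ y → y < V × (x + y) % V ≡ z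
  +-%-surjective x {z} z<V =
    (z + (V ∸ x % V)) % V , m%n<n _ V ,
    trans ([m+n%V]%V≡[m+n]%V x _) (trans (+-inverse-% x z) (m<n⇒m%n≡m z<V))

  %-wrap : ∀ {m} → V ≤ m → m < V + V → m % V + V ≡ m
  %-wrap {m} V≤m m<2V = begin
    m % V + V          ≡⟨ cong (_+ V) (m≤n⇒[n∸m]%m≡n%m V≤m) ⟨
    (m ∸ V) % V + V    ≡⟨ cong (_+ V) (m<n⇒m%n≡m m∸V<V) ⟩
    m ∸ V + V          ≡⟨ m∸n+n≡m V≤m ⟩
    m                  ∎
    where
    open ≡-Reasoning
    m∸V<V : m ∸ V < V
    m∸V<V = +-cancelʳ-< _ (m ∸ V) V (subst (_< V + V) (sym (m∸n+n≡m V≤m)) m<2V)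

  Arc : ℕ → ℕ → ℕ → Set
  Arc s n z = ∃ λ d → d < n × z ≡ suc ((s + d) % V)

  Arc⊆range : ∀ {s n} z → Arc s n z → 1 ≤ z × z ≤ V
  Arc⊆range {s} _ (d , _ , refl) = s≤s z≤n , m%n<n (s + d) V

  arc-interval : ∀ {s n} → s + n ≤ V → IsInterval (Arc s n)
  arc-interval {s} {n} s+n≤V = suc s , s + n , λ z → to z , from z
    where
    no-wrap : ∀ {d} → d < n → (s + d) % V ≡ s + d
    no-wrap d<n = m<n⇒m%n≡m (<-≤-trans (+-monoʳ-< s d<n) s+n≤V)
    to : ∀ z → Arc s n z → suc s ≤ z × z ≤ s + n
    to z (d , d<n , z≡) rewrite z≡ | no-wrap d<n = s≤s (m≤m+n s d) , +-monoʳ-< s d<n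
    from : ∀ z → suc s ≤ z × z ≤ s + n → Arc s n z
    from (suc z) (s<1+z , 1+z≤s+n) = d , d<n , cong suc (sym (trans (no-wrap d<n) s+d≡z))
      where
      d = z ∸ s
      s+d≡z : s + d ≡ z
      s+d≡z = m+[n∸m]≡n (s≤s⁻¹ s<1+z)
      d<n : d < n
      d<n = +-cancelˡ-< s d n (subst (λ r → suc r ≤ s + n) (sym s+d≡z) 1+z≤s+n)

  arc-complementary : ∀ {s n} → n ≤ V → Complementary V (Arc s n) (Arc ((s + n) % V) (V ∸ n))
  arc-complementary {s} {n} n≤V = record
    { P⊆range  = Arc⊆range
    ; Q⊆range  = Arc⊆range
    ; disjoint = disjoint
    ; cover    = cover
    }
    where
    rotate : ∀ e → ((s + n) % V + e) % V ≡ (s + (n + e)) % V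
    rotate e = trans ([m%V+n]%V≡[m+n]%V (s + n) e) (cong (_% V) (+-assoc s n e))
    disjoint : ∀ z → Arc s n z → Arc ((s + n) % V) (V ∸ n) z → ⊥
    disjoint z (d , d<n , refl) (e , e<V∸n , z≡) =
      m+n≮m n e (subst (_< n) (+-%-cancelˡ s (<-≤-trans d<n n≤V) n+e<V (trans (suc-injective z≡) (rotate e))) d<n)
      where
      n+e<V : n + e < V
      n+e<V = subst (n + e <_) (m+[n∸m]≡n n≤V) (+-monoʳ-< n e<V∸n)
    cover : ∀ z → 1 ≤ z × z ≤ V → Arc s n z ⊎ Arc ((s + n) % V) (V ∸ n) z
    cover (suc z) (_ , z<V) with +-%-surjective s z<V
    ... | y , y<V , s+y≡z with y <? n
    ...   | yes y<n = inj₁ (y , y<n , cong suc (sym s+y≡z))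
    ...   | no  y≮n = inj₂ (y ∸ n , ∸-monoˡ-< y<V (≮⇒≥ y≮n) , cong suc (sym (trans (rotate (y ∸ n)) s+[n+[y∸n]]≡z)))
      where
      s+[n+[y∸n]]≡z : (s + (n + (y ∸ n))) % V ≡ z
      s+[n+[y∸n]]≡z = trans (cong (λ r → (s + r) % V) (m+[n∸m]≡n (≮⇒≥ y≮n))) s+y≡z

  -- A wrapping arc is the complement of the arc that follows it, which does not wrap.
  arc-cyclic : ∀ {s n} → s < V → n ≤ V → CyclicInterval V (Arc s n)
  arc-cyclic {s} {n} s<V n≤V with s + n ≤? V
  ... | yes s+n≤V = inj₁ (arc-interval s+n≤V)
  ... | no  s+n≰V = complementary-cyclic (arc-complementary n≤V) (inj₁ (arc-interval follower-fits))
    where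
    s′ = (s + n) % V
    s′+V≡s+n : s′ + V ≡ s + n
    s′+V≡s+n = %-wrap (<⇒≤ (≰⇒> s+n≰V)) (+-mono-<-≤ s<V n≤V)
    follower-fits : s′ + (V ∸ n) ≤ V
    follower-fits = ≤-trans (≤-reflexive (+-cancelʳ-≡ n _ s (begin
      s′ + (V ∸ n) + n    ≡⟨ +-assoc s′ (V ∸ n) n ⟩
      s′ + (V ∸ n + n)    ≡⟨ cong (s′ +_) (m∸n+n≡m n≤V) ⟩
      s′ + V              ≡⟨ s′+V≡s+n ⟩
      s + n               ∎))) (<⇒≤ s<V)
      where open ≡-Reasoning

-- Complete multipartite graphs

edgeCount-suc : ∀ {m} (f : Fin (suc m) → ℕ) → edgeCount f ≡ f zero * sum (f ∘ suc) + edgeCount (f ∘ suc)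
edgeCount-suc f = cong (_+ edgeCount (f ∘ suc))
  (trans (sumFin≡sum (λ j → f zero * f (suc j))) (sym (*-distribˡ-sum (f zero) (f ∘ suc))))

square-sum : ∀ {m} (f : Fin m → ℕ) → sum f * sum f ≡ sum (λ i → f i * f i) + 2 * edgeCount f
square-sum {zero}  f = refl
square-sum {suc m} f = begin
  (a + S) * (a + S)                      ≡⟨ expand a S ⟩
  a * a + S * S + 2 * (a * S)            ≡⟨ cong (λ r → a * a + r + 2 * (a * S)) (square-sum (f ∘ suc)) ⟩
  a * a + (Q + 2 * E) + 2 * (a * S)      ≡⟨ regroup (a * a) Q E (a * S) ⟩
  a * a + Q + 2 * (a * S + E)            ≡⟨ cong (λ r → a * a + Q + 2 * r) (edgeCount-suc f) ⟨
  a * a + Q + 2 * edgeCount f            ∎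
  where
  open ≡-Reasoning
  a = f zero
  S = sum (f ∘ suc)
  Q = sum (λ i → f (suc i) * f (suc i))
  E = edgeCount (f ∘ suc)
  expand : ∀ a S → (a + S) * (a + S) ≡ a * a + S * S + 2 * (a * S)
  expand = solve-∀
  regroup : ∀ x Q E y → x + (Q + 2 * E) + 2 * y ≡ x + Q + 2 * (y + E)
  regroup = solve-∀

module Graph {k : ℕ} (ns : Fin k → ℕ) where

  ∑V : (Vertex ns → ℕ) → ℕ
  ∑V h = ∑[ i < suc k ] ∑[ j < sizes ns i ] h (i , j)

  ∑V-cong : {g h : Vertex ns → ℕ} → (∀ u → g u ≡ h u) → ∑V g ≡ ∑V h
  ∑V-cong g≗h = sum-cong-≗ λ i → sum-cong-≗ λ j → g≗h (i , j)

  ∑V-+ : (g h : Vertex ns → ℕ) → ∑V (λ u → g u + h u) ≡ ∑V g + ∑V h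
  ∑V-+ g h = trans (sum-cong-≗ λ i → ∑-distrib-+ (λ j → g (i , j)) (λ j → h (i , j)))
                   (∑-distrib-+ (λ i → ∑[ j < sizes ns i ] g (i , j)) (λ i → ∑[ j < sizes ns i ] h (i , j)))

  ∑V-*ʳ : (h : Vertex ns → ℕ) (c : ℕ) → ∑V (λ u → h u * c) ≡ ∑V h * c
  ∑V-*ʳ h c = sym (trans (*-distribʳ-sum c (λ i → ∑[ j < sizes ns i ] h (i , j)))
                         (sum-cong-≗ λ i → *-distribʳ-sum c (λ j → h (i , j))))

  ∑V-≥ : (h : Vertex ns → ℕ) (u : Vertex ns) → h u ≤ ∑V h
  ∑V-≥ h (i , j) = ≤-trans (sum-≥ (λ j → h (i , j)) j) (sum-≥ (λ i → ∑[ j < sizes ns i ] h (i , j)) i)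

  ∑V-pos : (h : Vertex ns → ℕ) → 1 ≤ ∑V h → ∃ λ u → 1 ≤ h u
  ∑V-pos h 1≤∑ =
    let i , 1≤∑i = sum-pos (λ i → ∑[ j < sizes ns i ] h (i , j)) 1≤∑
        j , 1≤hij = sum-pos (λ j → h (i , j)) 1≤∑i
    in (i , j) , 1≤hij

  ∑V-≤1 : (h : Vertex ns → ℕ) → (∀ u → h u ≤ 1) → (∀ u w → 1 ≤ h u → 1 ≤ h w → u ≡ w) →
          ∑V h ≤ 1
  ∑V-≤1 h ≤1 unique = sum-≤1 _ (λ i → sum-≤1 _ (λ j → ≤1 (i , j)) (unique-in i)) unique-part
    where
    unique-in : ∀ i j j′ → 1 ≤ h (i , j) → 1 ≤ h (i , j′) → j ≡ j′
    unique-in i j j′ p q = ,-injectiveʳ-UIP (Decidable⇒UIP.≡-irrelevant Fin._≟_) (unique (i , j) (i , j′) p q)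
    unique-part : ∀ i i′ → 1 ≤ ∑[ j < sizes ns i ] h (i , j) → 1 ≤ ∑[ j < sizes ns i′ ] h (i′ , j) →
                  i ≡ i′
    unique-part i i′ p q =
      let j , p′ = sum-pos (λ j → h (i , j)) p
          j′ , q′ = sum-pos (λ j → h (i′ , j)) q
      in ,-injectiveˡ (unique (i , j) (i′ , j′) p′ q′)

  ∑V-comm : ∀ {n} (F : Vertex ns → Fin n → ℕ) → ∑V (λ u → sum (F u)) ≡ sum (λ x → ∑V (λ u → F u x))
  ∑V-comm F = trans (sum-cong-≗ λ i → ∑-comm (λ j x → F (i , j) x))
                    (∑-comm λ i x → ∑[ j < sizes ns i ] F (i , j) x)

  ∑V-swap : (F : Vertex ns → Vertex ns → ℕ) → ∑V (λ u → ∑V (F u)) ≡ ∑V (λ w → ∑V (λ u → F u w))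
  ∑V-swap F = trans (∑V-comm λ u i → ∑[ j < sizes ns i ] F u (i , j))
                    (sum-cong-≗ λ i → ∑V-comm λ u j → F u (i , j))

  ∑V-byPart : (f : Fin (suc k) → ℕ) → ∑V (f ∘ proj₁) ≡ ∑[ i < suc k ] (sizes ns i * f i)
  ∑V-byPart f = sum-cong-≗ λ i → sum-const (sizes ns i) (f i)

  sum-sizes : sum (sizes ns) ≡ 1 + sumFin ns
  sum-sizes = cong suc (sym (sumFin≡sum ns))

  _≟V_ : (u w : Vertex ns) → Dec (u ≡ w)
  _≟V_ = ≡-dec Fin._≟_ Fin._≟_

  adjacent? : (u w : Vertex ns) → Dec (Adj {ns = ns} u w)
  adjacent? u w = ¬? (proj₁ u Fin.≟ proj₁ w)

  degree : Vertex ns → ℕ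
  degree u = ∑V (λ w → 𝟙 (adjacent? u w))

  part-size : ∀ p → ∑V (λ w → 𝟙 (p Fin.≟ proj₁ w)) ≡ sizes ns p
  part-size p = begin
    ∑V (λ w → 𝟙 (p Fin.≟ proj₁ w))             ≡⟨ ∑V-byPart (λ i → 𝟙 (p Fin.≟ i)) ⟩
    ∑[ i < suc k ] (sizes ns i * 𝟙 (p Fin.≟ i))  ≡⟨ sum-single (λ i → sizes ns i * 𝟙 (p Fin.≟ i)) p off-p ⟩
    sizes ns p * 𝟙 (p Fin.≟ p)                   ≡⟨ cong (sizes ns p *_) (𝟙-yes (p Fin.≟ p) refl) ⟩
    sizes ns p * 1                               ≡⟨ *-identityʳ _ ⟩
    sizes ns p                                   ∎
    where
    open ≡-Reasoning
    off-p : ∀ i → i ≢ p → sizes ns i * 𝟙 (p Fin.≟ i) ≡ 0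
    off-p i i≢p = trans (cong (sizes ns i *_) (𝟙-no (p Fin.≟ i) (i≢p ∘ sym))) (*-zeroʳ (sizes ns i))

  degree+part-size : ∀ u → degree u + sizes ns (proj₁ u) ≡ 1 + sumFin ns
  degree+part-size u = begin
    degree u + sizes ns p                    ≡⟨ cong (degree u +_) (part-size p) ⟨
    degree u + ∑V same-part                  ≡⟨ ∑V-+ (λ w → 𝟙 (adjacent? u w)) same-part ⟨
    ∑V (λ w → 𝟙 (adjacent? u w) + same-part w) ≡⟨ ∑V-cong (λ w → 𝟙-¬?+𝟙 (p Fin.≟ proj₁ w)) ⟩
    ∑V (λ _ → 1)                             ≡⟨ ∑V-byPart (λ _ → 1) ⟩
    ∑[ i < suc k ] (sizes ns i * 1)          ≡⟨ sum-cong-≗ (λ i → *-identityʳ (sizes ns i)) ⟩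
    sum (sizes ns)                           ≡⟨ sum-sizes ⟩
    1 + sumFin ns                            ∎
    where
    open ≡-Reasoning
    p = proj₁ u
    same-part = λ w → 𝟙 (p Fin.≟ proj₁ w)

  handshake : ∑V degree ≡ 2 * edgeCount (sizes ns)
  handshake = +-cancelʳ-≡ Q _ _ (begin
    ∑V degree + Q                                       ≡⟨ cong (∑V degree +_) (∑V-byPart (sizes ns)) ⟨
    ∑V degree + ∑V (λ u → sizes ns (proj₁ u))           ≡⟨ ∑V-+ degree (λ u → sizes ns (proj₁ u)) ⟨
    ∑V (λ u → degree u + sizes ns (proj₁ u))            ≡⟨ ∑V-cong (λ u → trans (degree+part-size u) (sym sum-sizes)) ⟩
    ∑V (λ _ → sum (sizes ns))                           ≡⟨ ∑V-byPart (λ _ → sum (sizes ns)) ⟩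
    ∑[ i < suc k ] (sizes ns i * sum (sizes ns))        ≡⟨ *-distribʳ-sum (sum (sizes ns)) (sizes ns) ⟨
    sum (sizes ns) * sum (sizes ns)                     ≡⟨ square-sum (sizes ns) ⟩
    Q + 2 * edgeCount (sizes ns)                        ≡⟨ +-comm Q _ ⟩
    2 * edgeCount (sizes ns) + Q                        ∎)
    where
    open ≡-Reasoning
    Q = ∑[ i < suc k ] (sizes ns i * sizes ns i)

module Coloring {k : ℕ} {ns : Fin k → ℕ} {t : ℕ} {c : Vertex ns → Vertex ns → ℕ}
                (proper-coloring : ProperColoring ns t c) where
  open Graph ns
  open ProperColoring proper-coloring

  edgeOfColor : Vertex ns → ℕ → Vertex ns → ℕ
  edgeOfColor u x w = 𝟙 (adjacent? u w) * 𝟙 (c u w ≟ x)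

  colorCount : Vertex ns → ℕ → ℕ
  colorCount u x = ∑V (edgeOfColor u x)

  InS⊆range : ∀ u x → InS ns c u x → 1 ≤ x × x ≤ t
  InS⊆range u _ (w , u~w , refl) = inRange u w u~w

  colorCount≤1 : ∀ u x → colorCount u x ≤ 1
  colorCount≤1 u x = ∑V-≤1 (edgeOfColor u x) (λ w → 𝟙*𝟙≤1 (adjacent? u w) (c u w ≟ x)) unique
    where
    unique : ∀ w w′ → 1 ≤ edgeOfColor u x w → 1 ≤ edgeOfColor u x w′ → w ≡ w′
    unique w w′ p q with 𝟙*𝟙-sound (adjacent? u w) (c u w ≟ x) p | 𝟙*𝟙-sound (adjacent? u w′) (c u w′ ≟ x) q
    ... | u~w , cw≡x | u~w′ , cw′≡x with w ≟V w′
    ...   | yes w≡w′ = w≡w′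
    ...   | no  w≢w′ = contradiction (trans cw≡x (sym cw′≡x)) (proper u w w′ u~w u~w′ w≢w′)

  colorCount-indicates : ∀ u → Indicates (colorCount u) (InS ns c u)
  colorCount-indicates u x with 1 ≤? colorCount u x
  ... | yes 1≤count = inj₁ (present , ≤-antisym (colorCount≤1 u x) 1≤count)
    where
    present : InS ns c u x
    present = let w , 1≤edge = ∑V-pos (edgeOfColor u x) 1≤count in w , 𝟙*𝟙-sound (adjacent? u w) (c u w ≟ x) 1≤edge
  ... | no 1≰count = inj₂ (absent , n<1⇒n≡0 (≰⇒> 1≰count))
    where
    absent : ¬ InS ns c u x
    absent (w , u~w , cw≡x) =
      1≰count (subst (_≤ colorCount u x) (𝟙*𝟙-yes (adjacent? u w) (c u w ≟ x) u~w cw≡x) (∑V-≥ (edgeOfColor u x) w))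

  ∑neighbors-by-color : ∀ u (h : ℕ → ℕ) →
    ∑V (λ w → 𝟙 (adjacent? u w) * h (c u w)) ≡ ∑< (suc t) (λ x → colorCount u x * h x)
  ∑neighbors-by-color u h = begin
    ∑V (λ w → A w * h (c u w))                               ≡⟨ ∑V-cong pick ⟩
    ∑V (λ w → A w * ∑< (suc t) (λ x → C w x * h x))          ≡⟨ ∑V-cong (λ w → *-distribˡ-sum (A w) (weighted w)) ⟩
    ∑V (λ w → ∑< (suc t) (λ x → A w * (C w x * h x)))        ≡⟨ ∑V-comm (λ w i → A w * weighted w i) ⟩
    ∑< (suc t) (λ x → ∑V (λ w → A w * (C w x * h x)))        ≡⟨ ∑<-cong (suc t) (λ x _ → pull-out x) ⟩
    ∑< (suc t) (λ x → colorCount u x * h x)                  ∎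
    where
    open ≡-Reasoning
    A = λ w → 𝟙 (adjacent? u w)
    C = λ w x → 𝟙 (c u w ≟ x)
    weighted : Vertex ns → Fin (suc t) → ℕ
    weighted w i = C w (toℕ i) * h (toℕ i)
    pick : ∀ w → A w * h (c u w) ≡ A w * ∑< (suc t) (λ x → C w x * h x)
    pick w with adjacent? u w
    ... | yes u~w = cong (1 *_) (sym (∑<-pick h (s≤s (proj₂ (inRange u w u~w)))))
    ... | no _    = refl
    pull-out : ∀ x → ∑V (λ w → A w * (C w x * h x)) ≡ colorCount u x * h x
    pull-out x = trans (∑V-cong {λ w → A w * (C w x * h x)} λ w → sym (*-assoc (A w) (C w x) (h x)))
                       (∑V-*ʳ (edgeOfColor u x) (h x))

  degree-by-color : ∀ u → degree u ≡ ∑< (suc t) (colorCount u)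
  degree-by-color u = begin
    degree u                               ≡⟨ ∑V-cong (λ w → *-identityʳ (𝟙 (adjacent? u w))) ⟨
    ∑V (λ w → 𝟙 (adjacent? u w) * 1)       ≡⟨ ∑neighbors-by-color u (λ _ → 1) ⟩
    ∑< (suc t) (λ x → colorCount u x * 1)  ≡⟨ ∑<-cong (suc t) (λ x _ → *-identityʳ (colorCount u x)) ⟩
    ∑< (suc t) (colorCount u)              ∎
    where open ≡-Reasoning

  degree≤colors : ∀ u → degree u ≤ t
  degree≤colors u = begin
    degree u                                    ≡⟨ degree-by-color u ⟩
    colorCount u 0 + ∑< t (colorCount u ∘ suc)  ≡⟨ cong (_+ ∑< t (colorCount u ∘ suc)) no-color-0 ⟩
    ∑< t (colorCount u ∘ suc)                   ≤⟨ sum-mono {t} {g = λ _ → 1} (λ i → colorCount≤1 u (suc (toℕ i))) ⟩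
    sum {t} (λ _ → 1)                           ≡⟨ trans (sum-const t 1) (*-identityʳ t) ⟩
    t                                           ∎
    where
    open ≤-Reasoning
    no-color-0 : colorCount u 0 ≡ 0
    no-color-0 with colorCount-indicates u 0
    ... | inj₁ (has-0 , _)   = contradiction (proj₁ (InS⊆range u 0 has-0)) λ ()
    ... | inj₂ (_ , count≡0) = count≡0

  oddDegree : Vertex ns → ℕ
  oddDegree u = ∑V (λ w → 𝟙 (adjacent? u w) * parity (c u w))

  oddDegree-half : ∀ {u s D} → CyclicInterval t (InS ns c u) → t ≡ s * 2 → degree u ≡ D * 2 → oddDegree u ≡ D
  oddDegree-half {u} {s} {D} cyclic t≡ degree≡ =
    trans (∑neighbors-by-color u parity)
          (cyclicInterval-parity {s = s} {D = D} (colorCount-indicates u) (InS⊆range u) t≡ count cyclic)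
    where
    count : ∑< (suc t) (colorCount u) ≡ D * 2
    count = trans (sym (degree-by-color u)) degree≡

  -- Each odd-colored edge is counted twice: from its endpoint in the part of smaller index, and from the other.
  ∑oddDegree-even : 2 ∣ ∑V oddDegree
  ∑oddDegree-even = divides X (begin
    ∑V oddDegree                                          ≡⟨ ∑V-cong (λ u → ∑V-cong (split u)) ⟩
    ∑V (λ u → ∑V (λ w → forward u w + backward w u))      ≡⟨ ∑V-cong (λ u → ∑V-+ (forward u) (λ w → backward w u)) ⟩
    ∑V (λ u → ∑V (forward u) + ∑V (λ w → backward w u))   ≡⟨ ∑V-+ (λ u → ∑V (forward u)) (λ u → ∑V (λ w → backward w u)) ⟩
    X + ∑V (λ u → ∑V (λ w → backward w u))                ≡⟨ cong (X +_) (∑V-swap (λ u w → backward w u)) ⟩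
    X + ∑V (λ w → ∑V (backward w))                        ≡⟨ cong (X +_) (∑V-cong λ w → ∑V-cong (backward≡forward w)) ⟩
    X + X                                                 ≡⟨ cong (X +_) (+-identityʳ X) ⟨
    2 * X                                                 ≡⟨ *-comm 2 X ⟩
    X * 2                                                 ∎)
    where
    open ≡-Reasoning
    forward backward : Vertex ns → Vertex ns → ℕ
    forward u w = 𝟙 (proj₁ u Fin.<? proj₁ w) * parity (c u w)
    backward w u = 𝟙 (proj₁ w Fin.<? proj₁ u) * parity (c u w)
    X = ∑V (λ u → ∑V (forward u))
    split : ∀ u w → 𝟙 (adjacent? u w) * parity (c u w) ≡ forward u w + backward w u
    split u w = trans (cong (_* parity (c u w)) (𝟙-≢-split (proj₁ u) (proj₁ w)))
                      (*-distribʳ-+ (parity (c u w)) (𝟙 (proj₁ u Fin.<? proj₁ w)) _)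
    backward≡forward : ∀ w u → backward w u ≡ forward w u
    backward≡forward w u with proj₁ w Fin.<? proj₁ u
    ... | yes w<u = cong (λ r → 1 * parity r) (symmetric u w λ u≡w → Fin.<-irrefl (sym u≡w) w<u)
    ... | no _    = refl

evenEdgeCount : ∀ {k} {ns : Fin k → ℕ} {t c} → CyclicIntervalColoring ns t c →
                2 ∣ t → (∀ u → 2 ∣ Graph.degree ns u) → 2 ∣ edgeCount (sizes ns)
evenEdgeCount {ns = ns} cic (divides s t≡) degree-even =
  divides X (*-cancelʳ-≡ _ _ 2 (begin
    edgeCount (sizes ns) * 2              ≡⟨ *-comm (edgeCount (sizes ns)) 2 ⟩
    2 * edgeCount (sizes ns)              ≡⟨ handshake ⟨
    ∑V degree                             ≡⟨ ∑V-cong degree≡ ⟩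
    ∑V (λ u → oddDegree u * 2)            ≡⟨ ∑V-*ʳ oddDegree 2 ⟩
    ∑V oddDegree * 2                      ≡⟨ cong (_* 2) ∑odd≡ ⟩
    X * 2 * 2                             ∎))
  where
  open ≡-Reasoning
  open CyclicIntervalColoring cic
  open Graph ns
  open Coloring isProper
  X = _∣_.quotient ∑oddDegree-even
  ∑odd≡ = _∣_.equality ∑oddDegree-even
  degree≡ : ∀ u → degree u ≡ oddDegree u * 2
  degree≡ u = let divides D degree≡D*2 = degree-even u in
    trans degree≡D*2 (cong (_* 2) (sym (oddDegree-half {u} {s} {D} (cyclic u) t≡ degree≡D*2)))

-- Lower bound

odd⇒2∣1+n : ∀ {n} → Odd n → 2 ∣ suc n
odd⇒2∣1+n {n} odd = divides (suc (n / 2)) (cong suc (trans (m≡m%n+[m/n]*n n 2) (cong (_+ n / 2 * 2) odd)))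

odd-suc⇒2∣n : ∀ {n} → Odd (suc n) → 2 ∣ n
odd-suc⇒2∣n odd = ∣m+n∣m⇒∣n (odd⇒2∣1+n odd) (divides 1 refl)

odd⇒2∤ : ∀ {n} → Odd n → ¬ 2 ∣ n
odd⇒2∤ {n} odd 2∣n = 0≢1+n (trans (sym (n∣m⇒m%n≡0 n 2 2∣n)) odd)

even-sum-of-odds : ∀ {k} (ns : Fin k → ℕ) → 2 ∣ k → (∀ i → Odd (ns i)) → 2 ∣ sum ns
even-sum-of-odds {k} ns 2∣k ns-odd = ∣m+n∣m⇒∣n (subst (2 ∣_) ∑suc≡ (∣-sum (suc ∘ ns) (odd⇒2∣1+n ∘ ns-odd))) 2∣k
  where
  ∑suc≡ : sum (suc ∘ ns) ≡ k + sum ns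
  ∑suc≡ = trans (∑-distrib-+ (λ _ → 1) ns) (cong (_+ sum ns) (trans (sum-const k 1) (*-identityʳ k)))

module _ {k : ℕ} (ns : Fin k → ℕ) (k+1-odd : Odd (suc k)) (ns-odd : ∀ i → Odd (ns i)) where
  open Graph ns

  size-odd : ∀ p → Odd (sizes ns p)
  size-odd zero    = refl
  size-odd (suc i) = ns-odd i

  Σns-even : 2 ∣ sumFin ns
  Σns-even = subst (2 ∣_) (sym (sumFin≡sum ns)) (even-sum-of-odds ns (odd-suc⇒2∣n k+1-odd) ns-odd)

  even-degree : ∀ u → 2 ∣ degree u
  even-degree u = ∣m+n∣m⇒∣n (subst (2 ∣_) 2+Σ≡ (∣m∣n⇒∣m+n (divides 1 refl) Σns-even))
                            (odd⇒2∣1+n {sizes ns (proj₁ u)} (size-odd (proj₁ u)))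
    where
    2+Σ≡ : 2 + sumFin ns ≡ suc (sizes ns (proj₁ u)) + degree u
    2+Σ≡ = cong suc (trans (sym (degree+part-size u)) (+-comm (degree u) _))

  lowerBound : Odd (edgeCount (sizes ns)) → ∀ t → HasCIC ns t → 1 + sumFin ns ≤ t
  lowerBound E-odd t (c , cic) with suc (sumFin ns) ≤? t
  ... | yes Σ<t = Σ<t
  ... | no  Σ≮t = contradiction (evenEdgeCount cic (subst (2 ∣_) (sym t≡Σ) Σns-even) even-degree) (odd⇒2∤ E-odd)
    where
    open Coloring (CyclicIntervalColoring.isProper cic)
    center-degree : degree (zero , zero) ≡ sumFin ns
    center-degree = suc-injective (trans (+-comm 1 _) (degree+part-size (zero , zero)))
    t≡Σ : t ≡ sumFin ns
    t≡Σ = ≤-antisym (≮⇒≥ Σ≮t) (subst (_≤ t) center-degree (degree≤colors (zero , zero)))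

offset : ∀ {m} → (Fin m → ℕ) → Fin m → ℕ
offset f zero    = 0
offset f (suc i) = f zero + offset (f ∘ suc) i

offset+≤sum : ∀ {m} (f : Fin m → ℕ) i → offset f i + f i ≤ sum f
offset+≤sum f zero    = m≤m+n (f zero) _
offset+≤sum f (suc i) =
  subst (_≤ sum f) (sym (+-assoc (f zero) _ _)) (+-monoʳ-≤ (f zero) (offset+≤sum (f ∘ suc) i))

offset-surjective : ∀ {m} (f : Fin m → ℕ) {y} → y < sum f →
                    ∃₂ λ i (j : Fin (f i)) → offset f i + toℕ j ≡ y
offset-surjective {suc m} f {y} y<∑ with y <? f zero
... | yes y<f₀ = zero , fromℕ< y<f₀ , Fin.toℕ-fromℕ< y<f₀
... | no  y≮f₀ = let i , j , eq = offset-surjective (f ∘ suc) y′<∑ in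
                 suc i , j , trans (+-assoc (f zero) _ _) (trans (cong (f zero +_) eq) f₀+y′≡y)
  where
  f₀+y′≡y : f zero + (y ∸ f zero) ≡ y
  f₀+y′≡y = m+[n∸m]≡n (≮⇒≥ y≮f₀)
  y′<∑ : y ∸ f zero < sum (f ∘ suc)
  y′<∑ = +-cancelˡ-< (f zero) _ _ (subst (_< sum f) (sym f₀+y′≡y) y<∑)

first-block-below : ∀ {m} (f : Fin (suc m) → ℕ) (j : Fin (f zero)) i (j′ : Fin (f (suc i))) →
                    toℕ j < offset f (suc i) + toℕ j′
first-block-below f j i j′ = <-≤-trans (Fin.toℕ<n j) (≤-trans (m≤m+n (f zero) _) (m≤m+n _ (toℕ j′)))

offset-injective : ∀ {m} (f : Fin m → ℕ) {i i′} (j : Fin (f i)) (j′ : Fin (f i′)) →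
                   offset f i + toℕ j ≡ offset f i′ + toℕ j′ → (Σ (Fin m) (Fin ∘ f) ∋ (i , j)) ≡ (i′ , j′)
offset-injective f {zero}  {zero}   j j′ eq = cong (zero ,_) (Fin.toℕ-injective eq)
offset-injective f {zero}  {suc i′} j j′ eq = contradiction eq (<⇒≢ (first-block-below f j i′ j′))
offset-injective f {suc i} {zero}   j j′ eq = contradiction (sym eq) (<⇒≢ (first-block-below f j′ i j))
offset-injective f {suc i} {suc i′} j j′ eq =
  cong (λ { (i , j) → suc i , j }) (offset-injective (f ∘ suc) j j′ (+-cancelˡ-≡ (f zero) _ _
    (trans (sym (+-assoc (f zero) _ (toℕ j))) (trans eq (+-assoc (f zero) _ (toℕ j′))))))

-- Upper bound

module Construction {k : ℕ} (ns : Fin k → ℕ) where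
  open Graph ns using (sum-sizes)

  V : ℕ
  V = 1 + sumFin ns

  encode : Vertex ns → ℕ
  encode (i , j) = offset (sizes ns) i + toℕ j

  part≤V : ∀ i → offset (sizes ns) i + sizes ns i ≤ V
  part≤V i = subst (offset (sizes ns) i + sizes ns i ≤_) sum-sizes (offset+≤sum (sizes ns) i)

  encode<V : ∀ u → encode u < V
  encode<V (i , j) = <-≤-trans (+-monoʳ-< (offset (sizes ns) i) (Fin.toℕ<n j)) (part≤V i)

  encode-injective : ∀ u w → encode u ≡ encode w → u ≡ w
  encode-injective (i , j) (i′ , j′) = offset-injective (sizes ns) j j′

  encode-surjective : ∀ {y} → y < V → ∃ λ u → encode u ≡ y
  encode-surjective {y} y<V =
    let i , j , eq = offset-surjective (sizes ns) (subst (y <_) (sym sum-sizes) y<V) in (i , j) , eq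

  color : Vertex ns → Vertex ns → ℕ
  color u w = suc ((encode u + encode w) % V)

  color-proper : ProperColoring ns V color
  color-proper = record
    { inRange   = λ u w _ → s≤s z≤n , m%n<n (encode u + encode w) V
    ; symmetric = λ u w _ → cong (λ m → suc (m % V)) (+-comm (encode u) (encode w))
    ; proper    = λ v u w _ _ u≢w eq →
        u≢w (encode-injective u w (+-%-cancelˡ (encode v) (encode<V u) (encode<V w) (suc-injective eq)))
    }

  missing-colors : ∀ i j → let x = encode (i , j) ; o = offset (sizes ns) i in
                   Complementary V (InS ns color (i , j)) (Arc ((x + o) % V) (sizes ns i))
  missing-colors i j = record
    { P⊆range  = λ { _ (u , _ , refl) → s≤s z≤n , m%n<n (x + encode u) V }
    ; Q⊆range  = Arc⊆range {s = (x + o) % V}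
    ; disjoint = disjoint
    ; cover    = cover
    }
    where
    v = (i , j)
    x = encode v
    o = offset (sizes ns) i
    rotate : ∀ d → ((x + o) % V + d) % V ≡ (x + (o + d)) % V
    rotate d = trans ([m%V+n]%V≡[m+n]%V (x + o) d) (cong (_% V) (+-assoc x o d))
    disjoint : ∀ z → InS ns color v z → Arc ((x + o) % V) (sizes ns i) z → ⊥
    disjoint z (u , v~u , refl) (d , d<n , z≡) = v~u (sym (,-injectiveˡ (encode-injective u (i , j′) encode-u≡)))
      where
      j′ = fromℕ< d<n
      encode-u≡ : encode u ≡ encode (i , j′)
      encode-u≡ = +-%-cancelˡ x (encode<V u) (encode<V (i , j′)) (begin
        (x + encode u) % V         ≡⟨ suc-injective z≡ ⟩
        ((x + o) % V + d) % V      ≡⟨ rotate d ⟩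
        (x + (o + d)) % V          ≡⟨ cong (λ r → (x + (o + r)) % V) (Fin.toℕ-fromℕ< d<n) ⟨
        (x + encode (i , j′)) % V  ∎)
        where open ≡-Reasoning
    cover : ∀ z → 1 ≤ z × z ≤ V → InS ns color v z ⊎ Arc ((x + o) % V) (sizes ns i) z
    cover (suc z) (_ , z<V) with +-%-surjective x z<V
    ... | y , y<V , x+y≡z with encode-surjective y<V
    ...   | (i′ , j′) , refl with i′ Fin.≟ i
    ...     | yes refl = inj₂ (toℕ j′ , Fin.toℕ<n j′ , cong suc (sym (trans (rotate (toℕ j′)) x+y≡z)))
    ...     | no  i′≢i = inj₁ ((i′ , j′) , (i′≢i ∘ sym) , cong suc x+y≡z)

  color-cyclic : ∀ v → CyclicInterval V (InS ns color v)
  color-cyclic v@(i , j) = complementary-cyclic (missing-colors i j)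
    (arc-cyclic (m%n<n (encode v + offset (sizes ns) i) V) (≤-trans (m≤n+m (sizes ns i) _) (part≤V i)))

  upperBound : HasCIC ns V
  upperBound = color , record { isProper = color-proper ; cyclic = color-cyclic }

corollary10 : (k : ℕ) (ns : Fin k → ℕ) →
    1 ≤ k →
    Odd (suc k) →
    (∀ i → 1 ≤ ns i) →
    (∀ i → Odd (ns i)) →
    Odd (edgeCount (sizes ns)) →
    WcEq ns (1 + sumFin ns)
corollary10 k ns _ k+1-odd _ ns-odd E-odd = Construction.upperBound ns , lowerBound ns k+1-odd ns-odd E-odd
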